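{- In an abstractly guarded category, if $f\colon X\to_\sigma Y$ for a summand $\sigma\colon Y'\triangleleft Y$ and $h\colon Y\to Z$ is an isomorphism, then $h\circ f\colon X\to_{h\sigma}Z$.
   Context: A summand $\sigma\colon Y'\triangleleft Y$ is a pair $(\sigma_1\colon Y'\to Y,\sigma_2\colon Y_2\to Y)$ forming a coproduct cospan; $h\sigma=(h\circ\sigma_1,h\circ\sigma_2)$, a summand of $Z$. The category (with finite coproducts) is abstractly guarded if equipped with a relation $f\colon X\to_\sigma Y$ between morphisms and summands of their codomain closed under: (trv) $\mathrm{inl}\circ f\colon X\to_{\mathrm{inr}}Y+Z$ for all $f\colon X\to Y$; (par) $f\colon X\to_\sigma Z$, $g\colon Y\to_\sigma Z$ imply $[f,g]\colon X+Y\to_\sigma Z$; (cmp) $f\colon X\to_{\mathrm{inr}}Y+Z$, $g\colon Y\to_\sigma V$, $h\colon Z\to V$ imply $[g,h]\circ f\colon X\to_\sigma V$; here $Y+Z$ ranges over all coproducts. -}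

module Defs where

open import Level using (Level; _⊔_; suc)
open import Relation.Binary.PropositionalEquality using (_≡_)

record Category (o ℓ : Level) : Set (suc (o ⊔ ℓ)) where
  infixr 9 _∘_
  field
    Obj  : Set o
    Hom  : Obj → Obj → Set ℓ
    id   : ∀ {A} → Hom A A
    _∘_  : ∀ {A B C} → Hom B C → Hom A B → Hom A C
    assoc     : ∀ {A B C D} (f : Hom A B) (g : Hom B C) (h : Hom C D) →
                (h ∘ g) ∘ f ≡ h ∘ (g ∘ f)
    identityˡ : ∀ {A B} (f : Hom A B) → id ∘ f ≡ f
    identityʳ : ∀ {A B} (f : Hom A B) → f ∘ id ≡ f

module _ {o ℓ : Level} (𝒞 : Category o ℓ) where
  open Category 𝒞

  record IsCoproduct {A B C : Obj} (i₁ : Hom A C) (i₂ : Hom B C) : Set (o ⊔ ℓ) where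
    field
      [_,_]  : ∀ {D} → Hom A D → Hom B D → Hom C D
      inject₁ : ∀ {D} {f : Hom A D} {g : Hom B D} → [ f , g ] ∘ i₁ ≡ f
      inject₂ : ∀ {D} {f : Hom A D} {g : Hom B D} → [ f , g ] ∘ i₂ ≡ g
      unique  : ∀ {D} {f : Hom A D} {g : Hom B D} (k : Hom C D) →
                k ∘ i₁ ≡ f → k ∘ i₂ ≡ g → k ≡ [ f , g ]

  record Coproduct (A B : Obj) : Set (o ⊔ ℓ) where
    field
      A+B : Obj
      inl : Hom A A+B
      inr : Hom B A+B
      isCoproduct : IsCoproduct inl inr
    open IsCoproduct isCoproduct public

  record IsInitial (I : Obj) : Set (o ⊔ ℓ) where
    field
      ¡        : ∀ {A} → Hom I A
      ¡-unique : ∀ {A} (f : Hom I A) → f ≡ ¡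

  record HasFiniteCoproducts : Set (o ⊔ ℓ) where
    field
      ⊥obj      : Obj
      ⊥-initial : IsInitial ⊥obj
      coproduct : ∀ A B → Coproduct A B

  -- A summand σ : Y' ◁ Y : a pair (σ₁ : Y' → Y, σ₂ : Y₂ → Y) forming a coproduct cospan.
  record Summand (Y : Obj) : Set (o ⊔ ℓ) where
    constructor summand
    field
      {Y'} : Obj
      {Y₂} : Obj
      σ₁ : Hom Y' Y
      σ₂ : Hom Y₂ Y
      isCoproduct : IsCoproduct σ₁ σ₂

  swapIsCoproduct : ∀ {A B C} {i₁ : Hom A C} {i₂ : Hom B C} →
                    IsCoproduct i₁ i₂ → IsCoproduct i₂ i₁
  swapIsCoproduct p = record
    { [_,_] = λ f g → [ g , f ]
    ; inject₁ = inject₂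
    ; inject₂ = inject₁
    ; unique = λ k e₁ e₂ → unique k e₂ e₁
    }
    where open IsCoproduct p

  -- The summand "inr" of a coproduct Y + Z, i.e. (inr, inl) : Z ◁ Y + Z.
  inrSummand : ∀ {A B} (c : Coproduct A B) → Summand (Coproduct.A+B c)
  inrSummand c = summand inr inl (swapIsCoproduct isCoproduct)
    where open Coproduct c

  record IsIso {A B : Obj} (h : Hom A B) : Set ℓ where
    field
      inv : Hom B A
      isoˡ : inv ∘ h ≡ id
      isoʳ : h ∘ inv ≡ id

  -- Abstract guardedness: a relation f : X →_σ Y between morphisms and
  -- summands of their codomain, closed under (trv), (par), (cmp).
  -- Y + Z ranges over all coproducts.
  record AbstractGuardedness (r : Level) : Set (o ⊔ ℓ ⊔ suc r) where
    field
      Guarded : ∀ {X Y} → Hom X Y → Summand Y → Set r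
      trv : ∀ {X Y Z} (c : Coproduct Y Z) (f : Hom X Y) →
            Guarded (Coproduct.inl c ∘ f) (inrSummand c)
      par : ∀ {X Y Z} (c : Coproduct X Y) {σ : Summand Z}
              {f : Hom X Z} {g : Hom Y Z} →
            Guarded f σ → Guarded g σ → Guarded (Coproduct.[_,_] c f g) σ
      cmp : ∀ {X Y Z V} (c : Coproduct Y Z) {σ : Summand V}
              {f : Hom X (Coproduct.A+B c)} {g : Hom Y V} (h : Hom Z V) →
            Guarded f (inrSummand c) → Guarded g σ →
            Guarded (Coproduct.[_,_] c g h ∘ f) σ

record AbstractlyGuardedCategory (o ℓ r : Level) : Set (suc (o ⊔ ℓ ⊔ r)) where
  field
    category : Category o ℓ
    finiteCoproducts : HasFiniteCoproducts category
    guardedness : AbstractGuardedness category r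

-- The complement injection σ₂ of any summand σ is guarded for σ (trv), and
-- (cmp) applied to the coproduct cospan σ shows that post-composition with k
-- preserves guardedness as soon as k ∘ σ₂ is guarded, since k = [ k ∘ σ₂ , k ∘ σ₁ ].
-- Invertibility of h serves only to make hσ a summand, which the statement
-- supplies separately as hσ-coprod; then k = h, τ = hσ.
module Submission where

open import Defs
open import Level using (Level)
open import Relation.Binary.PropositionalEquality using (_≡_; refl; sym; subst)

module Guardedness {o ℓ r : Level} (𝒞 : Category o ℓ) (G : AbstractGuardedness 𝒞 r) where
  open Category 𝒞
  open AbstractGuardedness G

  -- Read as Y₂ + Y', so that its inr-summand is σ itself (definitionally).
  summandCoproduct : ∀ {Y} (σ : Summand 𝒞 Y) → Coproduct 𝒞 (Summand.Y₂ σ) (Summand.Y' σ)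
  summandCoproduct (summand σ₁ σ₂ isCoproduct) = record
    { inl = σ₂ ; inr = σ₁ ; isCoproduct = swapIsCoproduct 𝒞 isCoproduct }

  σ₂-guarded : ∀ {Y} (σ : Summand 𝒞 Y) → Guarded (Summand.σ₂ σ) σ
  σ₂-guarded σ = subst (λ g → Guarded g σ) (identityʳ _) (trv (summandCoproduct σ) id)

  ∘-guarded : ∀ {X Y V} {f : Hom X Y} {σ : Summand 𝒞 Y} {τ : Summand 𝒞 V} (k : Hom Y V) →
              Guarded f σ → Guarded (k ∘ Summand.σ₂ σ) τ → Guarded (k ∘ f) τ
  ∘-guarded {f = f} {σ} {τ} k f-guarded kσ₂-guarded =
    subst (λ k′ → Guarded (k′ ∘ f) τ) (sym k≡[kσ₂,kσ₁])
          (cmp c (k ∘ Summand.σ₁ σ) f-guarded kσ₂-guarded)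
    where
    c : Coproduct 𝒞 (Summand.Y₂ σ) (Summand.Y' σ)
    c = summandCoproduct σ
    k≡[kσ₂,kσ₁] : k ≡ Coproduct.[_,_] c (k ∘ Summand.σ₂ σ) (k ∘ Summand.σ₁ σ)
    k≡[kσ₂,kσ₁] = Coproduct.unique c k refl refl

proposition3p3 : ∀ {o ℓ r : Level} (𝔾 : AbstractlyGuardedCategory o ℓ r) →
    let open AbstractlyGuardedCategory 𝔾
        open Category category
        open AbstractGuardedness guardedness
    in ∀ {X Y Z : Obj} (f : Hom X Y) (σ : Summand category Y) (h : Hom Y Z) →
       Guarded f σ → IsIso category h →
       (hσ-coprod : IsCoproduct category (h ∘ Summand.σ₁ σ) (h ∘ Summand.σ₂ σ)) →
       Guarded (h ∘ f) (summand (h ∘ Summand.σ₁ σ) (h ∘ Summand.σ₂ σ) hσ-coprod)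
proposition3p3 𝔾 f σ h f-guarded _ hσ-coprod =
  ∘-guarded h f-guarded (σ₂-guarded (summand (h ∘ σ₁) (h ∘ σ₂) hσ-coprod))
  where
  open AbstractlyGuardedCategory 𝔾
  open Category category
  open Summand σ
  open Guardedness category guardedness
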